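{- Let $n\ge 1$, let $b_1,\dots,b_{n-1}$ be elements of a commutative ring $R$, and let $\lambda$ be an indeterminate. For $0\le k\le n$ let $D_k = \det\left(M_{b_1 \dots b_{k-1}}^{\lambda \dots \lambda}\right) \in R[\lambda]$, where $M_{b_1 \dots b_{k-1}}^{\lambda \dots \lambda}$ is the $k\times k$ matrix with $(i,j)$ entry $b_i$ if $i<j$, $b_j$ if $j<i$, and $\lambda$ if $i=j$, and $D_0=1$. For $1\le m\le n-1$ define \[ B_m = \begin{pmatrix} 2(\lambda - b_m) & -(b_m-\lambda)^2 \\ 1 & 0 \end{pmatrix}. \] Then \[ \begin{pmatrix} D_n \\ D_{n-1} \end{pmatrix} = B_{n-1} B_{n-2} \cdots B_1 \begin{pmatrix} \lambda \\ 1 \end{pmatrix}. \]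
   Context: The empty product of matrices (case $n=1$) is the identity matrix. -}

module Defs where

open import Level using (Level)
open import Algebra.Bundles using (CommutativeRing)
open import Data.Nat using (ℕ; zero; suc)
open import Data.Fin using (Fin; zero; suc; toℕ; punchIn)
open import Data.Fin.Properties using (<-cmp)
open import Relation.Binary.Definitions using (tri<; tri≈; tri>)
open import Function using (_∘_)

module _ {c ℓ : Level} (R : CommutativeRing c ℓ) where
  open CommutativeRing R using (Carrier; _+_; _*_; -_; _-_; 0#; 1#)

  altSum : (k : ℕ) → (Fin k → Carrier) → Carrier
  altSum zero    f = 0#
  altSum (suc k) f = f zero - altSum k (f ∘ suc)

  det : (k : ℕ) → (Fin k → Fin k → Carrier) → Carrier
  det zero    M = 1#
  det (suc k) M = altSum (suc k) (λ j → M zero j * det k (λ i l → M (suc i) (punchIn j l)))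

  -- Extend a finite sequence b_1..b_m (stored 0-based as Fin m → R) to ℕ → R by 0;
  -- the values beyond index m are never used below.
  ext : {m : ℕ} → (Fin m → Carrier) → ℕ → Carrier
  ext {zero}  b _       = 0#
  ext {suc m} b zero    = b zero
  ext {suc m} b (suc i) = ext (b ∘ suc) i

  -- The k×k matrix M^{λ…λ}_{b_1…b_{k-1}} (0-based indices i,j; paper's b_{i+1} is (bs i)):
  -- entry b_i if i<j, b_j if j<i, λ if i=j (paper's 1-based convention).
  Mat : (ℕ → Carrier) → Carrier → (k : ℕ) → Fin k → Fin k → Carrier
  Mat bs x k i j with <-cmp i j
  ... | tri< _ _ _ = bs (toℕ i)
  ... | tri≈ _ _ _ = x
  ... | tri> _ _ _ = bs (toℕ j)

  D : (ℕ → Carrier) → Carrier → ℕ → Carrier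
  D bs x k = det k (Mat bs x k)

  Mat2 : Set c
  Mat2 = Fin 2 → Fin 2 → Carrier

  _⊗_ : Mat2 → Mat2 → Mat2
  (A ⊗ B) i j = A i zero * B zero j + A i (suc zero) * B (suc zero) j

  _·v_ : Mat2 → (Fin 2 → Carrier) → Fin 2 → Carrier
  (A ·v v) i = A i zero * v zero + A i (suc zero) * v (suc zero)

  I₂ : Mat2
  I₂ zero zero = 1#
  I₂ zero (suc zero) = 0#
  I₂ (suc zero) zero = 0#
  I₂ (suc zero) (suc zero) = 1#

  Bm : Carrier → Carrier → Mat2
  Bm x y zero zero = (1# + 1#) * (x - y)
  Bm x y zero (suc zero) = - ((y - x) * (y - x))
  Bm x y (suc zero) zero = 1#
  Bm x y (suc zero) (suc zero) = 0#

  Bprod : (ℕ → Carrier) → Carrier → ℕ → Mat2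
  Bprod bs x zero    = I₂
  Bprod bs x (suc j) = Bm x (bs j) ⊗ Bprod bs x j

  start : Carrier → Fin 2 → Carrier
  start x zero = x
  start x (suc zero) = 1#

module Submission where

-- The matrices M_k = M^{x…x}_{b_1…b_{k-1}} satisfy the three-term recurrence
--   D_{k+2} = 2(x - b_{k+1}) D_{k+1} - (b_{k+1} - x)² D_k ,
-- i.e. (D_{k+2}, D_{k+1}) = B_{k+1} (D_{k+1}, D_k).  Together with (D_1, D_0) = (x, 1) the theorem
-- follows by induction on m (module Transfer).
--
-- The recurrence comes from a row operation on M_{k+2} (module Recurrence): its last row is the
-- previous row plus d·e_last - d·e_prev, where d = x - b_{k+1}.  The determinant is additive in the
-- last row and vanishes when the last two rows agree, so D_{k+2} = d·D_{k+1} + d·det W, where W is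
-- M_{k+2} without its last row and second-to-last column.  W differs from M_{k+1} only in its last
-- entry (b_{k+1} instead of x), hence det W = D_{k+1} + (b_{k+1} - x) D_k.
--
-- The determinant of Defs is the Laplace expansion along the first row, so these facts about the
-- last row (additivity; vanishing for a zero row or equal last two rows; expansion along a last row
-- that is a multiple of the last or second-to-last unit vector) are proved by induction on the size
-- through that expansion (module Determinant), using a few index identities for punchIn.

open import Level using (Level)
open import Algebra.Bundles using (CommutativeRing)
open import Data.Nat using (ℕ; zero; suc; z<s; s<s)
open import Data.Fin using (Fin; zero; suc; toℕ; punchIn; fromℕ; inject₁; _<_)
open import Data.Fin.Properties using (<-cmp; toℕ-fromℕ; toℕ-inject₁; fromℕ≢inject₁; inject₁-injective)
open import Data.Product using (_×_; _,_)
open import Data.Vec.Functional using (updateAt)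
open import Data.Vec.Functional.Properties using (updateAt-updates; updateAt-minimal)
open import Relation.Binary.Definitions using (tri<; tri≈; tri>)
open import Relation.Binary.PropositionalEquality as ≡ using (_≡_; _≢_)
open import Relation.Nullary using (contradiction)
open import Defs

punchIn-fromℕ : ∀ {n} (l : Fin n) → punchIn (fromℕ n) l ≡ inject₁ l
punchIn-fromℕ zero    = ≡.refl
punchIn-fromℕ (suc l) = ≡.cong suc (punchIn-fromℕ l)

punchIn-inject₁ : ∀ {n} (j : Fin (suc n)) (l : Fin n) →
  punchIn (inject₁ j) (inject₁ l) ≡ inject₁ (punchIn j l)
punchIn-inject₁ zero    l       = ≡.refl
punchIn-inject₁ (suc j) zero    = ≡.refl
punchIn-inject₁ (suc j) (suc l) = ≡.cong suc (punchIn-inject₁ j l)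

punchIn-inject₁-fromℕ : ∀ {n} (j : Fin (suc n)) → punchIn (inject₁ j) (fromℕ n) ≡ fromℕ (suc n)
punchIn-inject₁-fromℕ zero              = ≡.refl
punchIn-inject₁-fromℕ {suc n} (suc j) = ≡.cong suc (punchIn-inject₁-fromℕ j)

punchIn-prev-inject₁ : ∀ {n} (l : Fin n) →
  punchIn (inject₁ (fromℕ n)) (inject₁ l) ≡ inject₁ (inject₁ l)
punchIn-prev-inject₁ {n} l rewrite punchIn-inject₁ (fromℕ n) l | punchIn-fromℕ l = ≡.refl

punchIn-swap : ∀ {m} (i l : Fin (suc m)) →
  punchIn (inject₁ (inject₁ i)) (punchIn (inject₁ (fromℕ m)) l)
    ≡ punchIn (inject₁ (fromℕ (suc m))) (punchIn (inject₁ i) l)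
punchIn-swap zero          l       = ≡.refl
punchIn-swap {suc m} (suc i) zero    = ≡.refl
punchIn-swap {suc m} (suc i) (suc l) = ≡.cong suc (punchIn-swap i l)

inject₁<fromℕ : ∀ {n} (i : Fin n) → inject₁ i < fromℕ n
inject₁<fromℕ zero    = z<s
inject₁<fromℕ (suc i) = s<s (inject₁<fromℕ i)

inject₁-mono-< : ∀ {n} {i j : Fin n} → i < j → inject₁ i < inject₁ j
inject₁-mono-< {i = zero}  {suc j} _         = z<s
inject₁-mono-< {i = suc i} {suc j} (s<s i<j) = s<s (inject₁-mono-< i<j)

data LastView {n : ℕ} : Fin (suc n) → Set where
  below : (j : Fin n) → LastView (inject₁ j)
  last  : LastView (fromℕ n)

lastView : ∀ {n} (j : Fin (suc n)) → LastView j
lastView {zero}  zero    = last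
lastView {suc n} zero    = below zero
lastView {suc n} (suc j) with lastView j
... | below j′ = below (suc j′)
... | last     = last

module Determinant {c ℓ : Level} (R : CommutativeRing c ℓ) where
  open CommutativeRing R hiding (zero)
  open import Algebra.Properties.Ring ring using (-0#≈0#; -‿+-comm; -‿distribʳ-*; x[y-z]≈xy-xz)
  open import Algebra.Properties.CommutativeSemigroup *-commutativeSemigroup using (x∙yz≈y∙xz)
  open import Algebra.Properties.CommutativeSemigroup +-commutativeSemigroup using (interchange)
  open import Relation.Binary.Reasoning.Setoid setoid

  Matrix : ℕ → Set c
  Matrix n = Fin n → Fin n → Carrier

  minor : ∀ {n} → Fin (suc n) → Matrix (suc n) → Matrix n
  minor j M i l = M (suc i) (punchIn j l)

  leading : ∀ {n} → Matrix (suc n) → Matrix n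
  leading M i j = M (inject₁ i) (inject₁ j)

  SameTop : ∀ {n} → Matrix (suc n) → Matrix (suc n) → Set ℓ
  SameTop {n} M N = ∀ (i : Fin n) j → M (inject₁ i) j ≈ N (inject₁ i) j

  x-0≈x : ∀ a → a - 0# ≈ a
  x-0≈x a = trans (+-congˡ -0#≈0#) (+-identityʳ a)

  altSum-cong : ∀ k {f g : Fin k → Carrier} → (∀ j → f j ≈ g j) → altSum R k f ≈ altSum R k g
  altSum-cong zero    _ = refl
  altSum-cong (suc k) e = +-cong (e zero) (-‿cong (altSum-cong k (λ j → e (suc j))))

  altSum-+ : ∀ k (f g : Fin k → Carrier) →
    altSum R k (λ j → f j + g j) ≈ altSum R k f + altSum R k g
  altSum-+ zero    f g = sym (+-identityˡ 0#)
  altSum-+ (suc k) f g = begin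
    (f zero + g zero) - altSum R k (λ j → f (suc j) + g (suc j))
      ≈⟨ +-congˡ (-‿cong (altSum-+ k (λ j → f (suc j)) (λ j → g (suc j)))) ⟩
    (f zero + g zero) - (altSum R k (λ j → f (suc j)) + altSum R k (λ j → g (suc j)))
      ≈⟨ +-congˡ (sym (-‿+-comm _ _)) ⟩
    (f zero + g zero) + (- altSum R k (λ j → f (suc j)) - altSum R k (λ j → g (suc j)))
      ≈⟨ interchange _ _ _ _ ⟩
    (f zero - altSum R k (λ j → f (suc j))) + (g zero - altSum R k (λ j → g (suc j))) ∎

  altSum-* : ∀ k a (f : Fin k → Carrier) → altSum R k (λ j → a * f j) ≈ a * altSum R k f
  altSum-* zero    a f = sym (zeroʳ a)
  altSum-* (suc k) a f = begin
    a * f zero - altSum R k (λ j → a * f (suc j)) ≈⟨ +-congˡ (-‿cong (altSum-* k a (λ j → f (suc j)))) ⟩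
    a * f zero - a * altSum R k (λ j → f (suc j)) ≈⟨ sym (x[y-z]≈xy-xz a _ _) ⟩
    a * (f zero - altSum R k (λ j → f (suc j))) ∎

  altSum-zero : ∀ k (f : Fin k → Carrier) → (∀ j → f j ≈ 0#) → altSum R k f ≈ 0#
  altSum-zero zero    f e = refl
  altSum-zero (suc k) f e = begin
    f zero - altSum R k (λ j → f (suc j)) ≈⟨ +-cong (e zero) (-‿cong (altSum-zero k _ (λ j → e (suc j)))) ⟩
    0# - 0#                               ≈⟨ -‿inverseʳ 0# ⟩
    0#                                    ∎

  altSum-dropLast : ∀ k (f : Fin (suc k) → Carrier) → f (fromℕ k) ≈ 0# →
    altSum R (suc k) f ≈ altSum R k (λ j → f (inject₁ j))
  altSum-dropLast zero    f e = trans (+-congʳ e) (-‿inverseʳ 0#)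
  altSum-dropLast (suc k) f e = +-congˡ (-‿cong (altSum-dropLast k (λ j → f (suc j)) e))

  -- If f is -g shifted by one zero term inserted before the last position, the
  -- alternating sums are opposite: the inserted term flips the sign of g's last term.
  altSum-skip : ∀ k (f : Fin (suc (suc k)) → Carrier) (g : Fin (suc k) → Carrier) →
    (∀ i → f (inject₁ (inject₁ i)) ≈ - g (inject₁ i)) → f (inject₁ (fromℕ k)) ≈ 0# →
    f (fromℕ (suc k)) ≈ g (fromℕ k) → altSum R (suc (suc k)) f ≈ - altSum R (suc k) g
  altSum-skip zero f g _ e₀ eₗ = begin
    f zero - (f (suc zero) - 0#) ≈⟨ +-cong e₀ (-‿cong (+-congʳ eₗ)) ⟩
    0# - (g zero - 0#)           ≈⟨ +-identityˡ _ ⟩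
    - (g zero - 0#)              ∎
  altSum-skip (suc k) f g eᵢ e₀ eₗ = begin
    f zero - altSum R (suc (suc k)) (λ j → f (suc j))
      ≈⟨ +-cong (eᵢ zero) (-‿cong (altSum-skip k (λ j → f (suc j)) (λ j → g (suc j)) (λ i → eᵢ (suc i)) e₀ eₗ)) ⟩
    - g zero - - altSum R (suc k) (λ j → g (suc j))
      ≈⟨ -‿+-comm _ _ ⟩
    - (g zero - altSum R (suc k) (λ j → g (suc j))) ∎

  det-cong : ∀ n {M N : Matrix n} → (∀ i j → M i j ≈ N i j) → det R n M ≈ det R n N
  det-cong zero    _ = refl
  det-cong (suc n) e = altSum-cong (suc n) (λ j → *-cong (e zero j) (det-cong n (λ i l → e (suc i) (punchIn j l))))

  det₁ : (M : Matrix 1) → det R 1 M ≈ M zero zero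
  det₁ M = trans (x-0≈x _) (*-identityʳ _)

  det₂ : (M : Matrix 2) → det R 2 M ≈ M zero zero * M (suc zero) (suc zero) - M zero (suc zero) * M (suc zero) zero
  det₂ M = +-cong (*-congˡ (det₁ (minor zero M))) (-‿cong (trans (x-0≈x _) (*-congˡ (det₁ (minor (suc zero) M)))))

  det-additive : ∀ n (M N Q : Matrix (suc n)) → SameTop M N → SameTop M Q →
    (∀ j → M (fromℕ n) j ≈ N (fromℕ n) j + Q (fromℕ n) j) →
    det R (suc n) M ≈ det R (suc n) N + det R (suc n) Q
  det-additive zero M N Q _ _ e = begin
    det R 1 M                 ≈⟨ det₁ M ⟩
    M zero zero               ≈⟨ e zero ⟩
    N zero zero + Q zero zero ≈⟨ sym (+-cong (det₁ N) (det₁ Q)) ⟩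
    det R 1 N + det R 1 Q     ∎
  det-additive (suc n) M N Q eN eQ e =
    trans (altSum-cong (suc (suc n)) expand)
          (altSum-+ (suc (suc n)) (λ j → N zero j * det R (suc n) (minor j N)) (λ j → Q zero j * det R (suc n) (minor j Q)))
    where
    expand : ∀ j → M zero j * det R (suc n) (minor j M)
               ≈ N zero j * det R (suc n) (minor j N) + Q zero j * det R (suc n) (minor j Q)
    expand j = begin
      M zero j * det R (suc n) (minor j M)
        ≈⟨ *-congˡ (det-additive n (minor j M) (minor j N) (minor j Q) (λ i l → eN (suc i) _) (λ i l → eQ (suc i) _) (λ l → e _)) ⟩
      M zero j * (det R (suc n) (minor j N) + det R (suc n) (minor j Q))
        ≈⟨ distribˡ _ _ _ ⟩
      M zero j * det R (suc n) (minor j N) + M zero j * det R (suc n) (minor j Q)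
        ≈⟨ +-cong (*-congʳ (eN zero j)) (*-congʳ (eQ zero j)) ⟩
      N zero j * det R (suc n) (minor j N) + Q zero j * det R (suc n) (minor j Q) ∎

  det-zeroRow : ∀ n (M : Matrix (suc n)) → (∀ j → M (fromℕ n) j ≈ 0#) → det R (suc n) M ≈ 0#
  det-zeroRow zero    M e = trans (det₁ M) (e zero)
  det-zeroRow (suc n) M e = altSum-zero (suc (suc n)) (λ j → M zero j * det R (suc n) (minor j M)) (λ j →
    trans (*-congˡ (det-zeroRow n (minor j M) (λ l → e (punchIn j l)))) (zeroʳ _))

  det-equalRows : ∀ n (M : Matrix (suc (suc n))) →
    (∀ j → M (inject₁ (fromℕ n)) j ≈ M (fromℕ (suc n)) j) → det R (suc (suc n)) M ≈ 0#
  det-equalRows zero M e = begin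
    det R 2 M                                                              ≈⟨ det₂ M ⟩
    M zero zero * M (suc zero) (suc zero) - M zero (suc zero) * M (suc zero) zero
      ≈⟨ +-congˡ (-‿cong (*-cong (e (suc zero)) (sym (e zero)))) ⟩
    M zero zero * M (suc zero) (suc zero) - M (suc zero) (suc zero) * M zero zero
      ≈⟨ +-congˡ (-‿cong (*-comm _ _)) ⟩
    M zero zero * M (suc zero) (suc zero) - M zero zero * M (suc zero) (suc zero) ≈⟨ -‿inverseʳ _ ⟩
    0#                                                                     ∎
  det-equalRows (suc n) M e = altSum-zero (suc (suc (suc n))) (λ j → M zero j * det R (suc (suc n)) (minor j M)) (λ j →
    trans (*-congˡ (det-equalRows n (minor j M) (λ l → e (punchIn j l)))) (zeroʳ _))

  det-lastUnit : ∀ n c (M : Matrix (suc n)) → M (fromℕ n) (fromℕ n) ≈ c →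
    (∀ j → M (fromℕ n) (inject₁ j) ≈ 0#) → det R (suc n) M ≈ c * det R n (leading M)
  det-lastUnit zero c M eₗ _ = trans (det₁ M) (trans eₗ (sym (*-identityʳ c)))
  det-lastUnit (suc n) c M eₗ e₀ = begin
    det R (suc (suc n)) M
      ≈⟨ altSum-dropLast (suc n) (λ j → M zero j * det R (suc n) (minor j M)) lastTermVanishes ⟩
    altSum R (suc n) (λ j → M zero (inject₁ j) * det R (suc n) (minor (inject₁ j) M))
      ≈⟨ altSum-cong (suc n) term ⟩
    altSum R (suc n) (λ j → c * (M zero (inject₁ j) * det R n (minor j (leading M))))
      ≈⟨ altSum-* (suc n) c (λ j → leading M zero j * det R n (minor j (leading M))) ⟩
    c * det R (suc n) (leading M) ∎
    where
    lastRow : ∀ {l l′} → l ≡ l′ → M (fromℕ (suc n)) l ≈ M (fromℕ (suc n)) l′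
    lastRow eq = reflexive (≡.cong (M (fromℕ (suc n))) eq)

    lastTermVanishes : M zero (fromℕ (suc n)) * det R (suc n) (minor (fromℕ (suc n)) M) ≈ 0#
    lastTermVanishes = trans (*-congˡ (det-zeroRow n (minor (fromℕ (suc n)) M) (λ l → trans (lastRow (punchIn-fromℕ l)) (e₀ l)))) (zeroʳ _)

    term : ∀ j → M zero (inject₁ j) * det R (suc n) (minor (inject₁ j) M)
                   ≈ c * (M zero (inject₁ j) * det R n (minor j (leading M)))
    term j = begin
      M zero (inject₁ j) * det R (suc n) (minor (inject₁ j) M)
        ≈⟨ *-congˡ (det-lastUnit n c (minor (inject₁ j) M)
                      (trans (lastRow (punchIn-inject₁-fromℕ j)) eₗ)
                      (λ l → trans (lastRow (punchIn-inject₁ j l)) (e₀ _))) ⟩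
      M zero (inject₁ j) * (c * det R n (leading (minor (inject₁ j) M)))
        ≈⟨ *-congˡ (*-congˡ (det-cong n (λ i l → reflexive (≡.cong (M (suc (inject₁ i))) (punchIn-inject₁ j l))))) ⟩
      M zero (inject₁ j) * (c * det R n (minor j (leading M)))
        ≈⟨ x∙yz≈y∙xz _ _ _ ⟩
      c * (M zero (inject₁ j) * det R n (minor j (leading M))) ∎

  prevMinor : ∀ {n} → Matrix (suc (suc n)) → Matrix (suc n)
  prevMinor {n} M i l = M (inject₁ i) (punchIn (inject₁ (fromℕ n)) l)

  det-prevUnit : ∀ n c (M : Matrix (suc (suc n))) →
    M (fromℕ (suc n)) (inject₁ (fromℕ n)) ≈ c → M (fromℕ (suc n)) (fromℕ (suc n)) ≈ 0# →
    (∀ j → M (fromℕ (suc n)) (inject₁ (inject₁ j)) ≈ 0#) →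
    det R (suc (suc n)) M ≈ - (c * det R (suc n) (prevMinor M))
  det-prevUnit zero c M eₚ eₗ _ = begin
    det R 2 M                                                  ≈⟨ det₂ M ⟩
    M zero zero * M (suc zero) (suc zero) - M zero (suc zero) * M (suc zero) zero
      ≈⟨ +-cong (*-congˡ eₗ) (-‿cong (*-congˡ eₚ)) ⟩
    M zero zero * 0# - M zero (suc zero) * c                   ≈⟨ +-congʳ (zeroʳ _) ⟩
    0# - M zero (suc zero) * c                                 ≈⟨ +-identityˡ _ ⟩
    - (M zero (suc zero) * c)                                  ≈⟨ -‿cong (*-comm _ c) ⟩
    - (c * M zero (suc zero))                                  ≈⟨ sym (-‿cong (*-congˡ (det₁ (prevMinor M)))) ⟩
    - (c * det R 1 (prevMinor M))                              ∎
  det-prevUnit (suc n) c M eₚ eₗ e₀ = begin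
    det R (suc (suc (suc n))) M                       ≈⟨ altSum-skip (suc n) f g shiftedTerm prevTermVanishes lastTerm ⟩
    - altSum R (suc (suc n)) g                        ≈⟨ -‿cong (altSum-* (suc (suc n)) c (λ l → N zero l * det R (suc n) (minor l N))) ⟩
    - (c * det R (suc (suc n)) N)                     ∎
    where
    lst prv : Fin (suc (suc (suc n)))
    lst = fromℕ (suc (suc n))
    prv = inject₁ (fromℕ (suc n))

    N : Matrix (suc (suc n))
    N = prevMinor M

    f : Fin (suc (suc (suc n))) → Carrier
    f j = M zero j * det R (suc (suc n)) (minor j M)

    g : Fin (suc (suc n)) → Carrier
    g l = c * (N zero l * det R (suc n) (minor l N))

    row : ∀ r {l l′} → l ≡ l′ → M r l ≈ M r l′
    row r eq = reflexive (≡.cong (M r) eq)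

    shiftedTerm : ∀ i → f (inject₁ (inject₁ i)) ≈ - g (inject₁ i)
    shiftedTerm i = begin
      M zero (inject₁ (inject₁ i)) * det R (suc (suc n)) (minor (inject₁ (inject₁ i)) M)
        ≈⟨ *-congˡ (det-prevUnit n c (minor (inject₁ (inject₁ i)) M)
             (trans (row lst (≡.trans (punchIn-inject₁ (inject₁ i) (fromℕ n)) (≡.cong inject₁ (punchIn-inject₁-fromℕ i)))) eₚ)
             (trans (row lst (punchIn-inject₁-fromℕ (inject₁ i))) eₗ)
             (λ l → trans (row lst (≡.trans (punchIn-inject₁ (inject₁ i) (inject₁ l)) (≡.cong inject₁ (punchIn-inject₁ i l)))) (e₀ (punchIn i l)))) ⟩
      M zero (inject₁ (inject₁ i)) * - (c * det R (suc n) (prevMinor (minor (inject₁ (inject₁ i)) M)))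
        ≈⟨ *-cong (row zero (≡.sym (punchIn-prev-inject₁ i)))
                  (-‿cong (*-congˡ (det-cong (suc n) (λ r l → row (suc (inject₁ r)) (punchIn-swap i l))))) ⟩
      N zero (inject₁ i) * - (c * det R (suc n) (minor (inject₁ i) N))
        ≈⟨ sym (-‿distribʳ-* _ _) ⟩
      - (N zero (inject₁ i) * (c * det R (suc n) (minor (inject₁ i) N)))
        ≈⟨ -‿cong (x∙yz≈y∙xz _ _ _) ⟩
      - g (inject₁ i) ∎

    -- Deleting the second-to-last column leaves a zero last row.
    prevTermVanishes : f prv ≈ 0#
    prevTermVanishes = trans (*-congˡ (det-zeroRow (suc n) (minor prv M) zeroRow)) (zeroʳ _)
      where
      zeroRow : ∀ l → M lst (punchIn prv l) ≈ 0#
      zeroRow l with lastView l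
      ... | below l′ = trans (row lst (punchIn-prev-inject₁ l′)) (e₀ l′)
      ... | last     = trans (row lst (punchIn-inject₁-fromℕ (fromℕ (suc n)))) eₗ

    -- Deleting the last column leaves c times a unit last row, whose leading minor is a minor of N.
    lastTerm : f lst ≈ g (fromℕ (suc n))
    lastTerm = begin
      M zero lst * det R (suc (suc n)) (minor lst M)
        ≈⟨ *-congˡ (det-lastUnit (suc n) c (minor lst M)
             (trans (row lst (punchIn-fromℕ (fromℕ (suc n)))) eₚ)
             (λ j → trans (row lst (punchIn-fromℕ (inject₁ j))) (e₀ j))) ⟩
      M zero lst * (c * det R (suc n) (leading (minor lst M)))
        ≈⟨ *-cong (row zero (≡.sym (punchIn-inject₁-fromℕ (fromℕ (suc n)))))
                  (*-congˡ (det-cong (suc n) (λ r l → row (suc (inject₁ r))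
                    (≡.trans (punchIn-fromℕ (inject₁ l))
                      (≡.sym (≡.trans (≡.cong (punchIn prv) (punchIn-fromℕ l)) (punchIn-prev-inject₁ l))))))) ⟩
      N zero (fromℕ (suc n)) * (c * det R (suc n) (minor (fromℕ (suc n)) N))
        ≈⟨ x∙yz≈y∙xz _ _ _ ⟩
      g (fromℕ (suc n)) ∎

module Recurrence {c ℓ : Level} (R : CommutativeRing c ℓ) where
  open CommutativeRing R hiding (zero)
  open Determinant R
  open import Algebra.Properties.Ring ring using (-‿distribˡ-*; -‿involutive; ⁻¹-anti-homo‿-; xyx⁻¹≈y)
  open import Relation.Binary.Reasoning.Setoid setoid

  y+[x-y]≈x : ∀ x y → y + (x - y) ≈ x
  y+[x-y]≈x x y = trans (sym (+-assoc y x (- y))) (xyx⁻¹≈y y x)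

  -[-x*y]≈x*y : ∀ x y → - (- x * y) ≈ x * y
  -[-x*y]≈x*y x y = trans (-‿cong (sym (-‿distribˡ-* x y))) (-‿involutive _)

  -- The ring identity behind the transfer matrix: with e = -d, the combination
  -- d u + d (u + e v) has the coefficients 2d and -e² of the first row of B.
  transfer-identity : ∀ d e u v → d ≈ - e →
    d * u + d * (u + e * v) ≈ ((1# + 1#) * d) * u + (- (e * e)) * v
  transfer-identity d e u v d≈-e = begin
    d * u + d * (u + e * v)     ≈⟨ +-congˡ (distribˡ d u (e * v)) ⟩
    d * u + (d * u + d * (e * v)) ≈⟨ sym (+-assoc _ _ _) ⟩
    (d * u + d * u) + d * (e * v) ≈⟨ +-cong (sym (distribʳ u d d)) (sym (*-assoc d e v)) ⟩
    (d + d) * u + (d * e) * v   ≈⟨ +-cong (*-congʳ (sym two-times)) (*-congʳ (trans (*-congʳ d≈-e) (sym (-‿distribˡ-* e e)))) ⟩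
    ((1# + 1#) * d) * u + (- (e * e)) * v ∎
    where
    two-times : (1# + 1#) * d ≈ d + d
    two-times = trans (distribʳ d 1# 1#) (+-cong (*-identityˡ d) (*-identityˡ d))

  setLast : ∀ {n} → Matrix (suc n) → (Fin (suc n) → Carrier) → Matrix (suc n)
  setLast {n} M r = updateAt M (fromℕ n) (λ _ → r)

  setLast-last : ∀ {n} (M : Matrix (suc n)) r → setLast M r (fromℕ n) ≡ r
  setLast-last {n} M r = updateAt-updates (fromℕ n) M

  setLast-top : ∀ {n} (M : Matrix (suc n)) r (i : Fin n) → setLast M r (inject₁ i) ≡ M (inject₁ i)
  setLast-top {n} M r i = updateAt-minimal (inject₁ i) (fromℕ n) M (λ eq → fromℕ≢inject₁ (≡.sym eq))

  setLast-sameTop : ∀ {n} (M : Matrix (suc n)) r → SameTop M (setLast M r)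
  setLast-sameTop M r i j = reflexive (≡.sym (≡.cong-app (setLast-top M r i) j))

  setLast-lastRow : ∀ {n} (M : Matrix (suc n)) r j → setLast M r (fromℕ n) j ≈ r j
  setLast-lastRow M r j = reflexive (≡.cong-app (setLast-last M r) j)

  single : ∀ {n} → Fin n → Carrier → Fin n → Carrier
  single p v = updateAt (λ _ → 0#) p (λ _ → v)

  single-at : ∀ {n} (p : Fin n) v → single p v p ≡ v
  single-at p v = updateAt-updates p (λ _ → 0#)

  single-off : ∀ {n} {p j : Fin n} v → j ≢ p → single p v j ≡ 0#
  single-off {p = p} {j} v j≢p = updateAt-minimal j p (λ _ → 0#) j≢p

  single-last-below : ∀ {n} v (j : Fin n) → single (fromℕ n) v (inject₁ j) ≡ 0#
  single-last-below {n} v j = single-off v (λ eq → fromℕ≢inject₁ {n} {j} (≡.sym eq))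

  module _ (bs : ℕ → Carrier) (x : Carrier) where

    Mat-< : ∀ {n} {i j : Fin n} → i < j → Mat R bs x n i j ≡ bs (toℕ i)
    Mat-< {i = i} {j} i<j with <-cmp i j
    ... | tri< _ _ _    = ≡.refl
    ... | tri≈ i≮j _ _  = contradiction i<j i≮j
    ... | tri> i≮j _ _  = contradiction i<j i≮j

    Mat-> : ∀ {n} {i j : Fin n} → j < i → Mat R bs x n i j ≡ bs (toℕ j)
    Mat-> {i = i} {j} j<i with <-cmp i j
    ... | tri< _ _ j≮i = contradiction j<i j≮i
    ... | tri≈ _ _ j≮i = contradiction j<i j≮i
    ... | tri> _ _ _   = ≡.refl

    Mat-diag : ∀ {n} (i : Fin n) → Mat R bs x n i i ≡ x
    Mat-diag i with <-cmp i i
    ... | tri< _ i≢i _ = contradiction ≡.refl i≢i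
    ... | tri≈ _ _ _   = ≡.refl
    ... | tri> _ i≢i _ = contradiction ≡.refl i≢i

    Mat-leading : ∀ {n} (i j : Fin n) → Mat R bs x (suc n) (inject₁ i) (inject₁ j) ≡ Mat R bs x n i j
    Mat-leading i j with <-cmp i j
    ... | tri< i<j _ _ = ≡.trans (Mat-< (inject₁-mono-< i<j)) (≡.cong bs (toℕ-inject₁ i))
    ... | tri≈ _ ≡.refl _ = Mat-diag (inject₁ i)
    ... | tri> _ _ j<i = ≡.trans (Mat-> (inject₁-mono-< j<i)) (≡.cong bs (toℕ-inject₁ j))

    det-leading-setLast : ∀ n r → det R n (leading (setLast (Mat R bs x (suc n)) r)) ≈ D R bs x n
    det-leading-setLast n r = det-cong n (λ i j →
      reflexive (≡.trans (≡.cong-app (setLast-top (Mat R bs x (suc n)) r i) (inject₁ j)) (Mat-leading i j)))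

    -- One step of the recurrence, for the matrix of size k+2 with b = b_{k+1} (0-based bs k).
    module Step (k : ℕ) where
      M : Matrix (suc (suc k))
      M = Mat R bs x (suc (suc k))

      lst prv : Fin (suc (suc k))
      lst = fromℕ (suc k)
      prv = inject₁ (fromℕ k)

      b d : Carrier
      b = bs k
      d = x - b

      prv<lst : prv < lst
      prv<lst = inject₁<fromℕ (fromℕ k)

      toℕ-prv : toℕ prv ≡ k
      toℕ-prv = ≡.trans (toℕ-inject₁ (fromℕ k)) (toℕ-fromℕ k)

      M-lst-prv : M lst prv ≡ b
      M-lst-prv = ≡.trans (Mat-> prv<lst) (≡.cong bs toℕ-prv)

      M-prv-lst : M prv lst ≡ b
      M-prv-lst = ≡.trans (Mat-< prv<lst) (≡.cong bs toℕ-prv)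

      M-lst-below : ∀ j → M lst (inject₁ (inject₁ j)) ≡ M prv (inject₁ (inject₁ j))
      M-lst-below j = ≡.trans (Mat-> (inject₁<fromℕ (inject₁ j))) (≡.sym (Mat-> (inject₁-mono-< (inject₁<fromℕ j))))

      δ : Fin (suc (suc k)) → Carrier
      δ j = single lst d j + single prv (- d) j

      lst≢prv : lst ≢ prv
      lst≢prv = fromℕ≢inject₁

      below≢prv : ∀ j → inject₁ (inject₁ j) ≢ prv
      below≢prv j eq = fromℕ≢inject₁ (≡.sym (inject₁-injective eq))

      lastRow-split : ∀ j → M lst j ≈ M prv j + δ j
      lastRow-split j with lastView j
      ... | last = begin
        M lst lst                ≡⟨ Mat-diag lst ⟩
        x                        ≈⟨ sym (y+[x-y]≈x x b) ⟩
        b + d                    ≈⟨ +-congˡ (sym (+-identityʳ d)) ⟩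
        b + (d + 0#)             ≡⟨ ≡.cong₂ (λ u v → u + (d + v)) M-prv-lst (single-off (- d) lst≢prv) ⟨
        M prv lst + (d + single prv (- d) lst) ≡⟨ ≡.cong (λ u → M prv lst + (u + single prv (- d) lst)) (single-at lst d) ⟨
        M prv lst + δ lst        ∎
      ... | below j′ with lastView j′
      ...   | last = begin
        M lst prv                ≡⟨ M-lst-prv ⟩
        b                        ≈⟨ sym (y+[x-y]≈x b x) ⟩
        x + (b - x)              ≈⟨ +-congˡ (sym (⁻¹-anti-homo‿- x b)) ⟩
        x + - d                  ≈⟨ +-congˡ (sym (+-identityˡ (- d))) ⟩
        x + (0# + - d)           ≡⟨ ≡.cong₂ (λ u v → u + (v + - d)) (Mat-diag prv) (single-off d (λ eq → lst≢prv (≡.sym eq))) ⟨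
        M prv prv + (single lst d prv + - d) ≡⟨ ≡.cong (λ u → M prv prv + (single lst d prv + u)) (single-at prv (- d)) ⟨
        M prv prv + δ prv        ∎
      ...   | below j″ = begin
        M lst (inject₁ (inject₁ j″))            ≡⟨ M-lst-below j″ ⟩
        M prv (inject₁ (inject₁ j″))            ≈⟨ sym (trans (+-congˡ (+-identityʳ 0#)) (+-identityʳ _)) ⟩
        M prv (inject₁ (inject₁ j″)) + (0# + 0#) ≡⟨ ≡.cong₂ (λ u v → M prv (inject₁ (inject₁ j″)) + (u + v))
                                                     (single-last-below d (inject₁ j″)) (single-off (- d) (below≢prv j″)) ⟨
        M prv (inject₁ (inject₁ j″)) + δ (inject₁ (inject₁ j″)) ∎

      P Δ Δₗ Δₚ : Matrix (suc (suc k))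
      P  = setLast M (M prv)
      Δ  = setLast M δ
      Δₗ = setLast M (single lst d)
      Δₚ = setLast M (single prv (- d))

      topOf-Δ : ∀ r → SameTop Δ (setLast M r)
      topOf-Δ r i j = trans (sym (setLast-sameTop M δ i j)) (setLast-sameTop M r i j)

      split-M : det R (suc (suc k)) M ≈ det R (suc (suc k)) P + det R (suc (suc k)) Δ
      split-M = det-additive (suc k) M P Δ (setLast-sameTop M _) (setLast-sameTop M _) (λ j →
        trans (lastRow-split j) (sym (+-cong (setLast-lastRow M _ j) (setLast-lastRow M _ j))))

      split-Δ : det R (suc (suc k)) Δ ≈ det R (suc (suc k)) Δₗ + det R (suc (suc k)) Δₚ
      split-Δ = det-additive (suc k) Δ Δₗ Δₚ (topOf-Δ _) (topOf-Δ _) (λ j →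
        trans (setLast-lastRow M δ j) (sym (+-cong (setLast-lastRow M _ j) (setLast-lastRow M _ j))))

      -- P has equal last two rows; Δₗ and Δₚ are expanded along their unit last rows.
      P-vanishes : det R (suc (suc k)) P ≈ 0#
      P-vanishes = det-equalRows k P (λ j →
        trans (reflexive (≡.cong-app (setLast-top M _ (fromℕ k)) j)) (sym (setLast-lastRow M _ j)))

      Δₗ-value : det R (suc (suc k)) Δₗ ≈ d * D R bs x (suc k)
      Δₗ-value = trans
        (det-lastUnit (suc k) d Δₗ
          (trans (setLast-lastRow M _ lst) (reflexive (single-at lst d)))
          (λ j → trans (setLast-lastRow M _ (inject₁ j)) (reflexive (single-last-below d j))))
        (*-congˡ (det-leading-setLast (suc k) _))

      W : Matrix (suc k)
      W = prevMinor M

      Δₚ-value : det R (suc (suc k)) Δₚ ≈ d * det R (suc k) W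
      Δₚ-value = begin
        det R (suc (suc k)) Δₚ
          ≈⟨ det-prevUnit k (- d) Δₚ
               (trans (setLast-lastRow M _ prv) (reflexive (single-at prv (- d))))
               (trans (setLast-lastRow M _ lst) (reflexive (single-off (- d) lst≢prv)))
               (λ j → trans (setLast-lastRow M _ _) (reflexive (single-off (- d) (below≢prv j)))) ⟩
        - (- d * det R (suc k) (prevMinor Δₚ))
          ≈⟨ -‿cong (*-congˡ (det-cong (suc k) (λ i l → reflexive (≡.cong-app (setLast-top M (single prv (- d)) i) (punchIn prv l))))) ⟩
        - (- d * det R (suc k) W) ≈⟨ -[-x*y]≈x*y d _ ⟩
        d * det R (suc k) W ∎

      -- W is M^{x…x} of size k+1 except for its last entry, which is b instead of x.
      e : Carrier
      e = b - x

      M′ : Matrix (suc k)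
      M′ = Mat R bs x (suc k)

      Q : Matrix (suc k)
      Q = setLast M′ (single (fromℕ k) e)

      W-top : SameTop W M′
      W-top i l with lastView l
      ... | below l′ = reflexive (≡.trans (≡.cong (M (inject₁ (inject₁ i))) (punchIn-prev-inject₁ l′)) (Mat-leading (inject₁ i) (inject₁ l′)))
      ... | last     = begin
        M (inject₁ (inject₁ i)) (punchIn prv (fromℕ k)) ≡⟨ ≡.cong (M (inject₁ (inject₁ i))) (punchIn-inject₁-fromℕ (fromℕ k)) ⟩
        M (inject₁ (inject₁ i)) lst                      ≡⟨ Mat-< (inject₁<fromℕ (inject₁ i)) ⟩
        bs (toℕ (inject₁ (inject₁ i)))                   ≡⟨ Mat-< (inject₁-mono-< (inject₁<fromℕ i)) ⟨
        M (inject₁ (inject₁ i)) prv                      ≡⟨ Mat-leading (inject₁ i) (fromℕ k) ⟩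
        M′ (inject₁ i) (fromℕ k)                         ∎

      W-last : ∀ l → W (fromℕ k) l ≈ M′ (fromℕ k) l + Q (fromℕ k) l
      W-last l with lastView l
      ... | below l′ = begin
        M prv (punchIn prv (inject₁ l′))   ≡⟨ ≡.cong (M prv) (punchIn-prev-inject₁ l′) ⟩
        M prv (inject₁ (inject₁ l′))       ≡⟨ Mat-leading (fromℕ k) (inject₁ l′) ⟩
        M′ (fromℕ k) (inject₁ l′)          ≈⟨ sym (+-identityʳ _) ⟩
        M′ (fromℕ k) (inject₁ l′) + 0#     ≈⟨ +-congˡ (sym (trans (setLast-lastRow M′ _ (inject₁ l′))
                                                (reflexive (single-last-below e l′)))) ⟩
        M′ (fromℕ k) (inject₁ l′) + Q (fromℕ k) (inject₁ l′) ∎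
      ... | last = begin
        M prv (punchIn prv (fromℕ k))      ≡⟨ ≡.cong (M prv) (punchIn-inject₁-fromℕ (fromℕ k)) ⟩
        M prv lst                          ≡⟨ M-prv-lst ⟩
        b                                  ≈⟨ sym (y+[x-y]≈x b x) ⟩
        x + e                              ≈⟨ sym (+-cong (reflexive (Mat-diag (fromℕ k)))
                                                (trans (setLast-lastRow M′ _ (fromℕ k)) (reflexive (single-at (fromℕ k) e)))) ⟩
        M′ (fromℕ k) (fromℕ k) + Q (fromℕ k) (fromℕ k) ∎

      Q-value : det R (suc k) Q ≈ e * D R bs x k
      Q-value = trans
        (det-lastUnit k e Q
          (trans (setLast-lastRow M′ _ (fromℕ k)) (reflexive (single-at (fromℕ k) e)))
          (λ j → trans (setLast-lastRow M′ _ (inject₁ j)) (reflexive (single-last-below e j))))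
        (*-congˡ (det-leading-setLast k _))

      W-value : det R (suc k) W ≈ D R bs x (suc k) + e * D R bs x k
      W-value = trans
        (det-additive k W M′ Q W-top (λ i l → trans (W-top i l) (setLast-sameTop M′ _ i l)) W-last)
        (+-congˡ Q-value)

      recurrence : D R bs x (suc (suc k))
                     ≈ ((1# + 1#) * (x - b)) * D R bs x (suc k) + (- ((b - x) * (b - x))) * D R bs x k
      recurrence = begin
        det R (suc (suc k)) M                            ≈⟨ split-M ⟩
        det R (suc (suc k)) P + det R (suc (suc k)) Δ    ≈⟨ +-cong P-vanishes split-Δ ⟩
        0# + (det R (suc (suc k)) Δₗ + det R (suc (suc k)) Δₚ) ≈⟨ +-identityˡ _ ⟩
        det R (suc (suc k)) Δₗ + det R (suc (suc k)) Δₚ  ≈⟨ +-cong Δₗ-value (trans Δₚ-value (*-congˡ W-value)) ⟩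
        d * D R bs x (suc k) + d * (D R bs x (suc k) + e * D R bs x k)
          ≈⟨ transfer-identity d e _ _ (sym (⁻¹-anti-homo‿- b x)) ⟩
        ((1# + 1#) * d) * D R bs x (suc k) + (- (e * e)) * D R bs x k ∎

module Transfer {c ℓ : Level} (R : CommutativeRing c ℓ) where
  open CommutativeRing R hiding (zero)
  open import Algebra.Properties.CommutativeSemigroup +-commutativeSemigroup using (interchange)
  open Determinant R using (det₁)
  open Recurrence R using (Mat-diag; module Step)
  open import Relation.Binary.Reasoning.Setoid setoid hiding (start)

  ·v-assoc : ∀ (A B : Mat2 R) v i → _·v_ R (_⊗_ R A B) v i ≈ _·v_ R A (_·v_ R B v) i
  ·v-assoc A B v i = begin
    (a₀ * B zero zero + a₁ * B (suc zero) zero) * v₀ + (a₀ * B zero (suc zero) + a₁ * B (suc zero) (suc zero)) * v₁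
      ≈⟨ +-cong (distribʳ v₀ _ _) (distribʳ v₁ _ _) ⟩
    (a₀ * B zero zero * v₀ + a₁ * B (suc zero) zero * v₀) + (a₀ * B zero (suc zero) * v₁ + a₁ * B (suc zero) (suc zero) * v₁)
      ≈⟨ interchange _ _ _ _ ⟩
    (a₀ * B zero zero * v₀ + a₀ * B zero (suc zero) * v₁) + (a₁ * B (suc zero) zero * v₀ + a₁ * B (suc zero) (suc zero) * v₁)
      ≈⟨ +-cong (factor a₀ _ _ _ _) (factor a₁ _ _ _ _) ⟩
    a₀ * _·v_ R B v zero + a₁ * _·v_ R B v (suc zero) ∎
    where
    a₀ a₁ v₀ v₁ : Carrier
    a₀ = A i zero
    a₁ = A i (suc zero)
    v₀ = v zero
    v₁ = v (suc zero)

    factor : ∀ a p q r s → a * p * q + a * r * s ≈ a * (p * q + r * s)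
    factor a p q r s = trans (+-cong (*-assoc a p q) (*-assoc a r s)) (sym (distribˡ a _ _))

  ·v-cong : ∀ (A : Mat2 R) {u v : Fin 2 → Carrier} → (∀ i → u i ≈ v i) → ∀ i → _·v_ R A u i ≈ _·v_ R A v i
  ·v-cong A e i = +-cong (*-congˡ (e zero)) (*-congˡ (e (suc zero)))

  ·v-identity : ∀ v i → _·v_ R (I₂ R) v i ≈ v i
  ·v-identity v zero       = trans (+-cong (*-identityˡ _) (zeroˡ _)) (+-identityʳ _)
  ·v-identity v (suc zero) = trans (+-cong (zeroˡ _) (*-identityˡ _)) (+-identityˡ _)

  module _ (bs : ℕ → Carrier) (x : Carrier) where

    Dpair : ℕ → Fin 2 → Carrier
    Dpair k zero       = D R bs x (suc k)
    Dpair k (suc zero) = D R bs x k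

    Dpair-start : ∀ i → Dpair 0 i ≈ start R x i
    Dpair-start zero       = trans (det₁ (Mat R bs x 1)) (reflexive (Mat-diag bs x {1} zero))
    Dpair-start (suc zero) = refl

    Dpair-step : ∀ k i → Dpair (suc k) i ≈ _·v_ R (Bm R x (bs k)) (Dpair k) i
    Dpair-step k zero       = Step.recurrence bs x k
    Dpair-step k (suc zero) = sym (trans (+-cong (*-identityˡ _) (zeroˡ _)) (+-identityʳ _))

    Dpair≈Bprod : ∀ k i → Dpair k i ≈ _·v_ R (Bprod R bs x k) (start R x) i
    Dpair≈Bprod zero    i = trans (Dpair-start i) (sym (·v-identity (start R x) i))
    Dpair≈Bprod (suc k) i = begin
      Dpair (suc k) i                                                     ≈⟨ Dpair-step k i ⟩
      _·v_ R (Bm R x (bs k)) (Dpair k) i                                  ≈⟨ ·v-cong (Bm R x (bs k)) (Dpair≈Bprod k) i ⟩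
      _·v_ R (Bm R x (bs k)) (_·v_ R (Bprod R bs x k) (start R x)) i      ≈⟨ sym (·v-assoc (Bm R x (bs k)) (Bprod R bs x k) (start R x) i) ⟩
      _·v_ R (Bprod R bs x (suc k)) (start R x) i                         ∎

theorem2 : {c ℓ : Level} (R : CommutativeRing c ℓ) (m : ℕ)
    (b : Fin m → CommutativeRing.Carrier R) (x : CommutativeRing.Carrier R) →
    let open CommutativeRing R using (_≈_)
        bs = ext R b
        v = _·v_ R (Bprod R bs x m) (start R x)
    in (D R bs x (suc m) ≈ v zero) × (D R bs x m ≈ v (suc zero))
theorem2 R m b x = Dpair≈Bprod (ext R b) x m zero , Dpair≈Bprod (ext R b) x m (suc zero)
  where open Transfer R using (Dpair≈Bprod)
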